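{- Let $W$ be a DNF over the variables $x_{i,j}$ ($i,j\in[n]$) of degree $d$. There exists a normalized DNF $N$ of support size at most $2d+1$ such that $W$ accepts exactly the same total orders as $N$ does, and $\tilde{\mathbb{E}}[W]=\tilde{\mathbb{E}}[N]$.
   Context: A total order on $[n]$ is identified with the assignment to $x_{i,j}$ ($i,j\in[n]$) given by $x_{i,j}=1$ iff $i$ precedes $j$ (so $x_{i,i}=0$); a formula accepts a total order if it is satisfied by this assignment. Let $\mathrm{Ord}$ be the set of total orders on $[n]$. Terms $t$ are identified with polynomials $\prod_{\text{positive}}x_{i,j}\prod_{\text{negated}}(1-x_{i,j})$ and a DNF $D=\bigvee_{t\in D}t$ with $\sum_{t\in D}t-1$. Define the linear functional $\tilde{\mathbb{E}}[p]=\frac{1}{|\mathrm{Ord}|}\sum_{z\in\mathrm{Ord}}p(z)$ (so for a term, $\tilde{\mathbb{E}}[t]$ is the fraction of total orders satisfying $t$), and $\tilde{\mathbb{E}}[D]=\tilde{\mathbb{E}}[\sum_{t\in D}t-1]$. For $S\subseteq[n]$ with $|S|\ge2$ and a bijection $\pi:[|S|]\to S$, $[\![S]\!]_\pi$ denotes the term $x_{\pi(1),\pi(2)}x_{\pi(2),\pi(3)}\cdots x_{\pi(|S|-1),\pi(|S|)}$. A term mentions $i$ if it contains $x_{i,j}$ or $x_{j,i}$ (possibly negated) for some $j\neq i$; its support is the set of elements it mentions and its support size is the size of the support. A DNF $N$ is normalized if every term is of the form $[\![S]\!]_\pi$ for some $S$ containing $1$, and all terms have the same support size (the support size of $N$).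 -}

module Defs where

open import Data.Bool using (Bool; true; false; if_then_else_)
open import Data.Nat using (ℕ; zero; suc; _+_; _*_; _≤_; _<_; s≤s; z≤n; NonZero; >-nonZero)
open import Data.Fin using (Fin; _≟_)
open import Data.Fin as Fin using ()
open import Data.List using (List; []; _∷_; map; concatMap; _++_; length; allFin)
open import Data.Nat.ListAction using (sum)
open import Data.Product using (Σ; _×_; ∃; _,_)
open import Data.Integer using (ℤ; +_; _-_)
open import Data.Rational using (ℚ; _/_)
open import Relation.Nullary using (does)
open import Relation.Binary.PropositionalEquality using (_≡_)
open import Function.Definitions using (Injective)
open import Data.List.Relation.Unary.All using (All)

-- Variables x_{i,j}, literals, terms, DNFs over [n] (represented by Fin n;
-- element 1 of [n] is Fin.zero).

-- A literal: (true , i , j) is x_{i,j}; (false , i , j) is ¬ x_{i,j}.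
Literal : ℕ → Set
Literal n = Bool × Fin n × Fin n

-- A term is a conjunction of literals; a DNF is a disjunction of terms
-- (as a list; Ẽ counts terms with multiplicity).
Term : ℕ → Set
Term n = List (Literal n)

DNF : ℕ → Set
DNF n = List (Term n)

Assignment : ℕ → Set
Assignment n = Fin n → Fin n → Bool

HasDegree : ∀ {n} → ℕ → DNF n → Set
HasDegree d W = All (λ t → length t ≤ d) W

b2n : Bool → ℕ
b2n true = 1
b2n false = 0

litVal : ∀ {n} → Assignment n → Literal n → ℕ
litVal z (true  , i , j) = b2n (z i j)
litVal z (false , i , j) = b2n (if z i j then false else true)

termVal : ∀ {n} → Assignment n → Term n → ℕ
termVal z [] = 1
termVal z (l ∷ t) = litVal z l * termVal z t

dnfSum : ∀ {n} → Assignment n → DNF n → ℕ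
dnfSum z D = sum (map (termVal z) D)

litSat : ∀ {n} → Assignment n → Literal n → Bool
litSat z (true  , i , j) = z i j
litSat z (false , i , j) = if z i j then false else true

termSat : ∀ {n} → Assignment n → Term n → Bool
termSat z [] = true
termSat z (l ∷ t) = if litSat z l then termSat z t else false

accepts : ∀ {n} → DNF n → Assignment n → Bool
accepts D z = anyB D
  where
  anyB : List _ → Bool
  anyB [] = false
  anyB (t ∷ ts) = if termSat z t then true else anyB ts

-- Total orders on [n]: enumerated as the permutations of [n]
-- (each total order is listed exactly once), with x_{i,j} = 1 iff i precedes j.

insertions : ∀ {A : Set} → A → List A → List (List A)
insertions x [] = (x ∷ []) ∷ []
insertions x (y ∷ ys) = (x ∷ y ∷ ys) ∷ map (y ∷_) (insertions x ys)

perms : ∀ {A : Set} → List A → List (List A)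
perms [] = [] ∷ []
perms (x ∷ xs) = concatMap (insertions x) (perms xs)

memB : ∀ {n} → Fin n → List (Fin n) → Bool
memB j [] = false
memB j (a ∷ l) = if does (a ≟ j) then true else memB j l

precedes : ∀ {n} → List (Fin n) → Fin n → Fin n → Bool
precedes [] i j = false
precedes (a ∷ l) i j =
  if does (a ≟ i) then memB j l
  else (if does (a ≟ j) then false else precedes l i j)

Ord : (n : ℕ) → List (Assignment n)
Ord n = map precedes (perms (allFin n))

private
  insertions-pos : ∀ {A : Set} (x : A) (l : List A) → 0 < length (insertions x l)
  insertions-pos x [] = s≤s z≤n
  insertions-pos x (y ∷ ys) = s≤s z≤n

  ++-pos : ∀ {A : Set} (xs ys : List A) → 0 < length xs → 0 < length (xs ++ ys)
  ++-pos (x ∷ xs) ys _ = s≤s z≤n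

  perms-pos : ∀ {A : Set} (l : List A) → 0 < length (perms l)
  perms-pos [] = s≤s z≤n
  perms-pos (x ∷ xs) with perms xs | perms-pos xs
  ... | p ∷ ps | _ = ++-pos (insertions x p) _ (insertions-pos x p)

  map-pos : ∀ {A B : Set} (f : A → B) (l : List A) → 0 < length l → 0 < length (map f l)
  map-pos f (x ∷ l) _ = s≤s z≤n

Ord-pos : ∀ n → 0 < length (Ord n)
Ord-pos n = map-pos precedes (perms (allFin n)) (perms-pos (allFin n))

Ẽ : ∀ {n} → DNF n → ℚ
Ẽ {n} D = _/_ (sumℤ (map (λ z → + dnfSum z D - + 1) (Ord n))) (length (Ord n))
            {{ >-nonZero (Ord-pos n) }}
  where
  sumℤ : List ℤ → ℤ
  sumℤ [] = + 0
  sumℤ (a ∷ as) = a Data.Integer.+ sumℤ as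

chainTerm : ∀ {n k} → (Fin k → Fin n) → Term n
chainTerm {k = zero} π = []
chainTerm {k = suc zero} π = []
chainTerm {k = suc (suc k)} π =
  (true , π Fin.zero , π (Fin.suc Fin.zero)) ∷ chainTerm {k = suc k} (λ i → π (Fin.suc i))

-- t is of the form [[S]]_π with |S| = k, S ⊆ [n] containing 1 (the element with toℕ = 0),
-- π : [k] → S a bijection (i.e. π injective into [n] with image S).
IsChainTerm : ∀ {n} → ℕ → Term n → Set
IsChainTerm {n} k t =
  Σ (Fin k → Fin n) λ π → Injective _≡_ _≡_ π × (∃ λ i → Fin.toℕ (π i) ≡ 0) × (t ≡ chainTerm π)

-- N is normalized with support size k (support of [[S]]_π is S, of size k; k ≥ 2).
NormalizedOfSize : ∀ {n} → ℕ → DNF n → Set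
NormalizedOfSize k N = (2 ≤ k) × All (IsChainTerm k) N

module Submission where

-- At a total order z every term takes the value 0 or 1, and for a list B of distinct elements
-- exactly one ordering c of B is a chain of z, i.e. has [[c]](z) = 1: inserting the elements
-- one at a time, x fits into exactly one position of a chain.  On that ordering z agrees with
-- the order of c, so a term t mentioning only elements of B equals, at every total order, the
-- sum of [[c]] over the orderings c of B that satisfy t.  Choosing B ∋ 1 containing the support
-- of t and of the common size k = min(n, 2d+1) turns W into a normalized N with
-- Σ_{t∈W} t(z) = Σ_{t∈N} t(z) at every total order z; acceptance and Ẽ only depend on these sums.

open import Defs
open import Data.Bool using (Bool; true; false; not; if_then_else_)
open import Data.Nat using (ℕ; zero; suc; _+_; _*_; _≤_; _<_; _⊓_; _<ᵇ_; s≤s)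
open import Data.Nat.Properties
  using (≤-reflexive; ≤-trans; <⇒≱; +-suc; +-comm; +-identityʳ; m≤m+n; m+[n∸m]≡n;
         *-identityˡ; *-identityʳ; *-zeroʳ; *-distribˡ-+; *-suc; *-monoʳ-≤; ⊓-glb; ⊓-monoʳ-≤; m⊓n≤m; m⊓n≤n)
open import Data.Nat.ListAction using (sum)
open import Data.Nat.ListAction.Properties using (sum-++)
import Data.Integer as ℤ
open import Data.Fin using (Fin; _≟_)
import Data.Fin as Fin
open import Data.Fin.Properties using (injective⇒≤; ¬∀⟶∃¬)
open import Data.List using (List; []; _∷_; _++_; length; lookup; map; concatMap; filterᵇ; deduplicate; allFin)
open import Data.List.Properties using (map-∘; map-++; map-cong-local; length-deduplicate)
open import Data.List.Membership.Propositional using (_∈_; _∉_)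
open import Data.List.Membership.Propositional.Properties using (∈-lookup; ∈-allFin; ∈-deduplicate⁺)
open import Data.List.Relation.Binary.Subset.Propositional using (_⊆_)
open import Data.List.Relation.Binary.Permutation.Propositional
  using (_↭_; ↭-refl; ↭-sym; ↭-trans; prep; swap; ↭⇒↭ₛ)
open import Data.List.Relation.Binary.Permutation.Propositional.Properties using (∈-resp-↭; ↭-length)
import Data.List.Relation.Binary.Permutation.Setoid.Properties as PermutationSetoid
open import Data.List.Relation.Unary.All using (All; []; _∷_)
import Data.List.Relation.Unary.All as All
open import Data.List.Relation.Unary.All.Properties using (All¬⇒¬Any; ¬Any⇒All¬; map⁺; concat⁺; filter⁺; ++⁺)
open import Data.List.Relation.Unary.Any using (here; there; index)
import Data.List.Relation.Unary.Any as Any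
open import Data.List.Relation.Unary.Any.Properties using (lookup-index)
open import Data.List.Relation.Unary.Unique.Propositional using (Unique; []; _∷_)
open import Data.List.Relation.Unary.Unique.Propositional.Properties using (allFin⁺)
import Data.List.Relation.Unary.Unique.DecPropositional.Properties as UniqueDec
open import Data.Product using (∃; _×_; _,_)
open import Function using (_∘_; id)
open import Function.Definitions using (Injective)
open import Relation.Nullary using (yes; no; contradiction)
open import Relation.Nullary.Decidable using (T?)
open import Relation.Binary.PropositionalEquality
  using (_≡_; _≢_; refl; sym; trans; cong; cong₂; subst; setoid; module ≡-Reasoning)

private variable
  n : ℕ
  A : Set

sum-map-*ˡ : ∀ m (f : A → ℕ) xs → sum (map (λ x → m * f x) xs) ≡ m * sum (map f xs)
sum-map-*ˡ m f [] = sym (*-zeroʳ m)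
sum-map-*ˡ m f (x ∷ xs) = trans (cong (m * f x +_) (sum-map-*ˡ m f xs)) (sym (*-distribˡ-+ m (f x) _))

sum-map-concatMap : ∀ {B : Set} (f : B → ℕ) (g : A → List B) xs →
  sum (map f (concatMap g xs)) ≡ sum (map (sum ∘ map f ∘ g) xs)
sum-map-concatMap f g [] = refl
sum-map-concatMap f g (x ∷ xs) = begin
  sum (map f (g x ++ concatMap g xs))          ≡⟨ cong sum (map-++ f (g x) _) ⟩
  sum (map f (g x) ++ map f (concatMap g xs))  ≡⟨ sum-++ (map f (g x)) _ ⟩
  sum (map f (g x)) + sum (map f (concatMap g xs))
    ≡⟨ cong (sum (map f (g x)) +_) (sum-map-concatMap f g xs) ⟩
  sum (map (sum ∘ map f ∘ g) (x ∷ xs))         ∎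
  where open ≡-Reasoning

sum-map-filterᵇ : ∀ (p : A → Bool) (f : A → ℕ) xs →
  sum (map f (filterᵇ p xs)) ≡ sum (map (λ x → b2n (p x) * f x) xs)
sum-map-filterᵇ p f [] = refl
sum-map-filterᵇ p f (x ∷ xs) with p x
... | true = cong₂ _+_ (sym (*-identityˡ (f x))) (sum-map-filterᵇ p f xs)
... | false = sum-map-filterᵇ p f xs

Unique-resp-↭ : ∀ {xs ys : List A} → xs ↭ ys → Unique xs → Unique ys
Unique-resp-↭ p = PermutationSetoid.Unique-resp-↭ (setoid _) (↭⇒↭ₛ p)

lookup-injective : ∀ {xs : List A} → Unique xs → Injective _≡_ _≡_ (lookup xs)
lookup-injective {xs = x ∷ xs} _ {Fin.zero} {Fin.zero} _ = refl
lookup-injective {xs = x ∷ xs} (x≢xs ∷ _) {Fin.zero} {Fin.suc j} eq =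
  contradiction (subst (_∈ xs) (sym eq) (∈-lookup j)) (All¬⇒¬Any x≢xs)
lookup-injective {xs = x ∷ xs} (x≢xs ∷ _) {Fin.suc i} {Fin.zero} eq =
  contradiction (subst (_∈ xs) eq (∈-lookup i)) (All¬⇒¬Any x≢xs)
lookup-injective {xs = x ∷ xs} (_ ∷ u) {Fin.suc i} {Fin.suc j} eq = cong Fin.suc (lookup-injective u eq)

Unique⇒length≤ : ∀ {xs : List (Fin n)} → Unique xs → length xs ≤ n
Unique⇒length≤ u = injective⇒≤ (lookup-injective u)

length<⇒∃∉ : ∀ (xs : List (Fin n)) → length xs < n → ∃ λ x → x ∉ xs
length<⇒∃∉ {n} xs |xs|<n = ¬∀⟶∃¬ n (_∈ xs) (λ x → Any.any? (x ≟_) xs) λ all∈ →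
  <⇒≱ |xs|<n (injective⇒≤ {f = index ∘ all∈} λ {i} {j} eq →
    trans (lookup-index (all∈ i)) (trans (cong (lookup xs) eq) (sym (lookup-index (all∈ j)))))

extend-unique-by : ∀ m {xs : List (Fin n)} → Unique xs → length xs + m ≤ n →
  ∃ λ ys → Unique ys × xs ⊆ ys × length ys ≡ length xs + m
extend-unique-by zero u _ = _ , u , id , sym (+-identityʳ _)
extend-unique-by (suc m) {xs} u bound =
  let bound′ = ≤-trans (≤-reflexive (sym (+-suc (length xs) m))) bound
      x , x∉xs = length<⇒∃∉ xs (≤-trans (s≤s (m≤m+n _ m)) bound′)
      ys , ys-unique , x∷xs⊆ys , |ys| = extend-unique-by m (¬Any⇒All¬ xs x∉xs ∷ u) bound′
  in ys , ys-unique , x∷xs⊆ys ∘ there , trans |ys| (sym (+-suc (length xs) m))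

extend-unique : ∀ {k} {xs : List (Fin n)} → Unique xs → length xs ≤ k → k ≤ n →
  ∃ λ ys → Unique ys × xs ⊆ ys × length ys ≡ k
extend-unique {xs = xs} u |xs|≤k k≤n =
  let ys , ys-unique , xs⊆ys , |ys| = extend-unique-by _ u (subst (_≤ _) (sym (m+[n∸m]≡n |xs|≤k)) k≤n)
  in ys , ys-unique , xs⊆ys , trans |ys| (m+[n∸m]≡n |xs|≤k)

record IsTotalOrder (z : Assignment n) : Set where
  field
    irreflexive : ∀ i → z i i ≡ false
    total : ∀ {i j} → i ≢ j → z i j ≡ not (z j i)
    transitive : ∀ {i j h} → z i j ≡ true → z j h ≡ true → z i h ≡ true

memB⇒∈ : ∀ {j : Fin n} l → memB j l ≡ true → j ∈ l
memB⇒∈ {j = j} (a ∷ l) eq with a ≟ j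
... | yes refl = here refl
... | no _ = there (memB⇒∈ l eq)

∈⇒memB : ∀ {j : Fin n} {l} → j ∈ l → memB j l ≡ true
∈⇒memB {j = j} (here refl) with j ≟ j
... | yes _ = refl
... | no j≢j = contradiction refl j≢j
∈⇒memB {j = j} {a ∷ l} (there j∈l) with a ≟ j
... | yes _ = refl
... | no _ = ∈⇒memB j∈l

∉⇒memB : ∀ {j : Fin n} {l} → j ∉ l → memB j l ≡ false
∉⇒memB {j = j} {l} j∉l with memB j l in eq
... | true = contradiction (memB⇒∈ l eq) j∉l
... | false = refl

precedes⇒∈ : ∀ l {i j : Fin n} → precedes l i j ≡ true → j ∈ l
precedes⇒∈ (a ∷ l) {i} {j} eq with a ≟ i
... | yes _ = there (memB⇒∈ l eq)
... | no _ with a ≟ j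
...   | yes _ = contradiction eq λ ()
...   | no _ = there (precedes⇒∈ l eq)

precedes-irreflexive : ∀ {l : List (Fin n)} → Unique l → ∀ i → precedes l i i ≡ false
precedes-irreflexive {l = []} _ i = refl
precedes-irreflexive {l = a ∷ l} (a≢l ∷ u) i with a ≟ i
... | yes refl = ∉⇒memB (All¬⇒¬Any a≢l)
... | no _ = precedes-irreflexive u i

precedes-total : ∀ {l : List (Fin n)} → Unique l → ∀ {i j} → i ∈ l → j ∈ l → i ≢ j →
  precedes l i j ≡ not (precedes l j i)
precedes-total {l = a ∷ l} (a≢l ∷ u) {i} {j} i∈ j∈ i≢j with a ≟ i | a ≟ j
... | yes refl | yes refl = contradiction refl i≢j
... | yes refl | no a≢j = ∈⇒memB (Any.tail (a≢j ∘ sym) j∈)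
... | no a≢i | yes refl = cong not (sym (∈⇒memB (Any.tail (a≢i ∘ sym) i∈)))
... | no a≢i | no a≢j = precedes-total u (Any.tail (a≢i ∘ sym) i∈) (Any.tail (a≢j ∘ sym) j∈) i≢j

precedes-transitive : ∀ (l : List (Fin n)) {i j h} →
  precedes l i j ≡ true → precedes l j h ≡ true → precedes l i h ≡ true
precedes-transitive (a ∷ l) {i} {j} {h} ij jh with a ≟ i | a ≟ j | a ≟ h
... | yes _ | yes _ | _     = jh
... | yes _ | no _  | yes _ = contradiction jh λ ()
... | yes _ | no _  | no _  = ∈⇒memB (precedes⇒∈ l jh)
... | no _  | yes _ | _     = contradiction ij λ ()
... | no _  | no _  | yes _ = contradiction jh λ ()
... | no _  | no _  | no _  = precedes-transitive l ij jh

precedes-isTotalOrder : ∀ {σ : List (Fin n)} → Unique σ → (∀ i → i ∈ σ) → IsTotalOrder (precedes σ)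
precedes-isTotalOrder {σ = σ} u ∈σ = record
  { irreflexive = precedes-irreflexive u
  ; total = precedes-total u (∈σ _) (∈σ _)
  ; transitive = precedes-transitive σ
  }

insertions-↭ : ∀ (x : A) ys → All (x ∷ ys ↭_) (insertions x ys)
insertions-↭ x [] = ↭-refl ∷ []
insertions-↭ x (y ∷ ys) =
  ↭-refl ∷ map⁺ (All.map (λ x∷ys↭c → ↭-trans (swap x y ↭-refl) (prep y x∷ys↭c)) (insertions-↭ x ys))

perms-↭ : ∀ (xs : List A) → All (xs ↭_) (perms xs)
perms-↭ [] = ↭-refl ∷ []
perms-↭ (x ∷ xs) = concat⁺ (map⁺ (All.map
  (λ {c} xs↭c → All.map (↭-trans (prep x xs↭c)) (insertions-↭ x c))
  (perms-↭ xs)))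

Ord-isTotalOrder : All IsTotalOrder (Ord n)
Ord-isTotalOrder {n} = map⁺ (All.map
  (λ ↭σ → precedes-isTotalOrder (Unique-resp-↭ ↭σ (allFin⁺ n)) (∈-resp-↭ ↭σ ∘ ∈-allFin))
  (perms-↭ (allFin n)))

litVal≡b2n-litSat : ∀ (z : Assignment n) l → litVal z l ≡ b2n (litSat z l)
litVal≡b2n-litSat z (true , _) = refl
litVal≡b2n-litSat z (false , _) = refl

termVal≡b2n-termSat : ∀ (z : Assignment n) t → termVal z t ≡ b2n (termSat z t)
termVal≡b2n-termSat z [] = refl
termVal≡b2n-termSat z (l ∷ t) rewrite litVal≡b2n-litSat z l with litSat z l
... | true = trans (*-identityˡ _) (termVal≡b2n-termSat z t)
... | false = refl

accepts≡0<ᵇdnfSum : ∀ (D : DNF n) z → accepts D z ≡ (0 <ᵇ dnfSum z D)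
accepts≡0<ᵇdnfSum [] z = refl
accepts≡0<ᵇdnfSum (t ∷ D) z rewrite termVal≡b2n-termSat z t with termSat z t
... | true = refl
... | false = accepts≡0<ᵇdnfSum D z

accepts-resp-dnfSum : ∀ (D D′ : DNF n) {z} → dnfSum z D ≡ dnfSum z D′ → accepts D z ≡ accepts D′ z
accepts-resp-dnfSum D D′ {z} eq =
  trans (accepts≡0<ᵇdnfSum D z) (trans (cong (0 <ᵇ_) eq) (sym (accepts≡0<ᵇdnfSum D′ z)))

Ẽ-resp-dnfSum : ∀ (D D′ : DNF n) → All (λ z → dnfSum z D ≡ dnfSum z D′) (Ord n) → Ẽ D ≡ Ẽ D′
Ẽ-resp-dnfSum D D′ eqs
  rewrite map-cong-local {f = λ z → ℤ.+ dnfSum z D ℤ.- ℤ.+ 1} {g = λ z → ℤ.+ dnfSum z D′ ℤ.- ℤ.+ 1}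
            (All.map (cong (λ s → ℤ.+ s ℤ.- ℤ.+ 1)) eqs) = refl

dnfSum-++ : ∀ (z : Assignment n) D D′ → dnfSum z (D ++ D′) ≡ dnfSum z D + dnfSum z D′
dnfSum-++ z D D′ = trans (cong sum (map-++ (termVal z) D D′)) (sum-++ (map (termVal z) D) _)

mentioned : Term n → List (Fin n)
mentioned = concatMap λ where (_ , i , j) → i ∷ j ∷ []

length-mentioned : ∀ (t : Term n) → length (mentioned t) ≡ 2 * length t
length-mentioned [] = refl
length-mentioned (_ ∷ t) = trans (cong (2 +_) (length-mentioned t)) (sym (*-suc 2 (length t)))

litSat-cong : ∀ {z w : Assignment n} s {i j} → z i j ≡ w i j → litSat z (s , i , j) ≡ litSat w (s , i , j)
litSat-cong true eq = eq
litSat-cong false eq = cong (λ b → if b then false else true) eq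

termSat-cong : ∀ {z w : Assignment n} {S} t → mentioned t ⊆ S →
  (∀ {i j} → i ∈ S → j ∈ S → z i j ≡ w i j) → termSat z t ≡ termSat w t
termSat-cong [] _ _ = refl
termSat-cong ((s , i , j) ∷ t) t⊆S agree =
  cong₂ (λ a b → if a then b else false) (litSat-cong s (agree (t⊆S (here refl)) (t⊆S (there (here refl)))))
    (termSat-cong t (t⊆S ∘ there ∘ there) agree)

chainOf : List (Fin n) → Term n
chainOf c = chainTerm (lookup c)

chainOf-isChainTerm : ∀ {c : List (Fin (suc n))} → Unique c → Fin.zero ∈ c → IsChainTerm (length c) (chainOf c)
chainOf-isChainTerm u 0∈c = _ , lookup-injective u , (index 0∈c , cong Fin.toℕ (sym (lookup-index 0∈c))) , refl

-- With y before h, x is after y exactly when it is between y and h or after h.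
between-or-after : ∀ (yx xh yh : Bool) V → (yx ≡ true → xh ≡ true → yh ≡ true) → (yh ≡ true → xh ≡ false → yx ≡ true) →
  b2n yx * (b2n xh * V) + b2n yh * (b2n (not xh) * V) ≡ b2n yx * (b2n yh * V)
between-or-after true  true  true  V _ _ = +-identityʳ _
between-or-after true  true  false V yxh _ = contradiction (yxh refl refl) λ ()
between-or-after true  false true  V _ _ = refl
between-or-after true  false false V _ _ = refl
between-or-after false true  true  V _ _ = refl
between-or-after false true  false V _ _ = refl
between-or-after false false true  V _ yhx = contradiction (yhx refl refl) λ ()
between-or-after false false false V _ _ = refl

sum-chains-insertions-after : ∀ {z : Assignment n} → IsTotalOrder z → ∀ x y ys → x ∉ y ∷ ys →
  sum (map (termVal z ∘ chainOf ∘ (y ∷_)) (insertions x ys)) ≡ b2n (z y x) * termVal z (chainOf (y ∷ ys))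
sum-chains-insertions-after tz x y [] _ = +-identityʳ _
sum-chains-insertions-after {z = z} tz x y (h ∷ r) x∉ = begin
  b2n (z y x) * (b2n (z x h) * V) + sum (map (termVal z ∘ chainOf ∘ (y ∷_)) (map (h ∷_) (insertions x r)))
    ≡⟨ cong (b2n (z y x) * (b2n (z x h) * V) +_) (begin
         sum (map (termVal z ∘ chainOf ∘ (y ∷_)) (map (h ∷_) (insertions x r)))
           ≡⟨ cong sum (sym (map-∘ (insertions x r))) ⟩
         sum (map (λ c → b2n (z y h) * termVal z (chainOf (h ∷ c))) (insertions x r))
           ≡⟨ sum-map-*ˡ (b2n (z y h)) (termVal z ∘ chainOf ∘ (h ∷_)) (insertions x r) ⟩
         b2n (z y h) * sum (map (termVal z ∘ chainOf ∘ (h ∷_)) (insertions x r))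
           ≡⟨ cong (b2n (z y h) *_) (sum-chains-insertions-after tz x h r (x∉ ∘ there)) ⟩
         b2n (z y h) * (b2n (z h x) * V) ∎) ⟩
  b2n (z y x) * (b2n (z x h) * V) + b2n (z y h) * (b2n (z h x) * V)
    ≡⟨ cong (λ b → b2n (z y x) * (b2n (z x h) * V) + b2n (z y h) * (b2n b * V)) (total h≢x) ⟩
  b2n (z y x) * (b2n (z x h) * V) + b2n (z y h) * (b2n (not (z x h)) * V)
    ≡⟨ between-or-after (z y x) (z x h) (z y h) V transitive
         (λ yh xh≡false → transitive yh (trans (total h≢x) (cong not xh≡false))) ⟩
  b2n (z y x) * (b2n (z y h) * V) ∎
  where
  open ≡-Reasoning
  open IsTotalOrder tz
  V = termVal z (chainOf (h ∷ r))
  h≢x : h ≢ x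
  h≢x h≡x = x∉ (there (here (sym h≡x)))

sum-chains-insertions : ∀ {z : Assignment n} → IsTotalOrder z → ∀ x ys → x ∉ ys →
  sum (map (termVal z ∘ chainOf) (insertions x ys)) ≡ termVal z (chainOf ys)
sum-chains-insertions tz x [] _ = refl
sum-chains-insertions {z = z} tz x (h ∷ r) x∉ = begin
  b2n (z x h) * V + sum (map (termVal z ∘ chainOf) (map (h ∷_) (insertions x r)))
    ≡⟨ cong (b2n (z x h) * V +_)
         (trans (cong sum (sym (map-∘ (insertions x r)))) (sum-chains-insertions-after tz x h r x∉)) ⟩
  b2n (z x h) * V + b2n (z h x) * V
    ≡⟨ cong (λ b → b2n (z x h) * V + b2n b * V) (IsTotalOrder.total tz λ h≡x → x∉ (here (sym h≡x))) ⟩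
  b2n (z x h) * V + b2n (not (z x h)) * V
    ≡⟨ one-or-other (z x h) ⟩
  V ∎
  where
  open ≡-Reasoning
  V = termVal z (chainOf (h ∷ r))
  one-or-other : ∀ b → b2n b * V + b2n (not b) * V ≡ V
  one-or-other true = trans (+-identityʳ _) (*-identityˡ V)
  one-or-other false = *-identityˡ V

sum-chains-perms : ∀ {z : Assignment n} → IsTotalOrder z → ∀ {xs} → Unique xs →
  sum (map (termVal z ∘ chainOf) (perms xs)) ≡ 1
sum-chains-perms tz {[]} _ = refl
sum-chains-perms {z = z} tz {x ∷ xs} (x≢xs ∷ u) = begin
  sum (map (termVal z ∘ chainOf) (concatMap (insertions x) (perms xs)))
    ≡⟨ sum-map-concatMap (termVal z ∘ chainOf) (insertions x) (perms xs) ⟩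
  sum (map (sum ∘ map (termVal z ∘ chainOf) ∘ insertions x) (perms xs))
    ≡⟨ cong sum (map-cong-local (All.map
         (λ {c} xs↭c → sum-chains-insertions tz x c (All¬⇒¬Any x≢xs ∘ ∈-resp-↭ (↭-sym xs↭c))) (perms-↭ xs))) ⟩
  sum (map (termVal z ∘ chainOf) (perms xs))
    ≡⟨ sum-chains-perms tz u ⟩
  1 ∎
  where open ≡-Reasoning

chainOf-sat⇒head-first : ∀ {z : Assignment n} → IsTotalOrder z → ∀ a r →
  termSat z (chainOf (a ∷ r)) ≡ true → ∀ {y} → y ∈ r → z a y ≡ true
chainOf-sat⇒head-first {z = z} tz a (b ∷ r) sat y∈ with z a b in ab | y∈
... | false | _ = contradiction sat λ ()
... | true | here refl = ab
... | true | there y∈r = IsTotalOrder.transitive tz ab (chainOf-sat⇒head-first tz b r sat y∈r)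

chainOf-sat-tail : ∀ {z : Assignment n} a r → termSat z (chainOf (a ∷ r)) ≡ true → termSat z (chainOf r) ≡ true
chainOf-sat-tail a [] _ = refl
chainOf-sat-tail {z = z} a (b ∷ r) sat with z a b
... | true = sat
... | false = contradiction sat λ ()

chainOf-sat⇒agrees : ∀ {z : Assignment n} → IsTotalOrder z → ∀ {c} → Unique c → termSat z (chainOf c) ≡ true →
  ∀ {i j} → i ∈ c → j ∈ c → z i j ≡ precedes c i j
chainOf-sat⇒agrees tz {a ∷ r} (a≢r ∷ u) sat {i} {j} i∈ j∈ with a ≟ i | a ≟ j
... | yes refl | yes refl = trans (irreflexive a) (sym (∉⇒memB (All¬⇒¬Any a≢r)))
  where open IsTotalOrder tz
... | yes refl | no a≢j = trans (chainOf-sat⇒head-first tz a r sat j∈r) (sym (∈⇒memB j∈r))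
  where j∈r = Any.tail (a≢j ∘ sym) j∈
... | no a≢i | yes refl = trans (total (a≢i ∘ sym)) (cong not (chainOf-sat⇒head-first tz a r sat i∈r))
  where open IsTotalOrder tz
        i∈r = Any.tail (a≢i ∘ sym) i∈
... | no a≢i | no a≢j = chainOf-sat⇒agrees tz u (chainOf-sat-tail a r sat) (Any.tail (a≢i ∘ sym) i∈) (Any.tail (a≢j ∘ sym) j∈)

_⊨_ : List (Fin n) → Term n → Bool
c ⊨ t = termSat (precedes c) t

chainExpansion : Term n → List (Fin n) → DNF n
chainExpansion t B = map chainOf (filterᵇ (_⊨ t) (perms B))

chainExpansion-isChainTerm : ∀ {k} (t : Term (suc n)) {B} → Unique B → Fin.zero ∈ B → length B ≡ k →
  All (IsChainTerm k) (chainExpansion t B)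
chainExpansion-isChainTerm t {B} u 0∈B |B| = map⁺ (filter⁺ (T? ∘ (_⊨ t)) (All.map
  (λ {c} B↭c → subst (λ m → IsChainTerm m (chainOf c)) (trans (sym (↭-length B↭c)) |B|)
                 (chainOf-isChainTerm (Unique-resp-↭ B↭c u) (∈-resp-↭ B↭c 0∈B)))
  (perms-↭ B)))

termVal*chainOf : ∀ {z : Assignment n} → IsTotalOrder z → ∀ t {c} → Unique c → mentioned t ⊆ c →
  termVal z t * termVal z (chainOf c) ≡ b2n (c ⊨ t) * termVal z (chainOf c)
termVal*chainOf {z = z} tz t {c} u t⊆c rewrite termVal≡b2n-termSat z (chainOf c) with termSat z (chainOf c) in sat
... | false = trans (*-zeroʳ (termVal z t)) (sym (*-zeroʳ (b2n (c ⊨ t))))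
... | true = cong (_* 1) (trans (termVal≡b2n-termSat z t) (cong b2n (termSat-cong t t⊆c (chainOf-sat⇒agrees tz u sat))))

termVal≡dnfSum-chainExpansion : ∀ {z : Assignment n} → IsTotalOrder z → ∀ t {B} → Unique B → mentioned t ⊆ B →
  termVal z t ≡ dnfSum z (chainExpansion t B)
termVal≡dnfSum-chainExpansion {z = z} tz t {B} u t⊆B = begin
  termVal z t
    ≡⟨ sym (*-identityʳ _) ⟩
  termVal z t * 1
    ≡⟨ cong (termVal z t *_) (sym (sum-chains-perms tz u)) ⟩
  termVal z t * sum (map (termVal z ∘ chainOf) (perms B))
    ≡⟨ sym (sum-map-*ˡ (termVal z t) (termVal z ∘ chainOf) (perms B)) ⟩
  sum (map (λ c → termVal z t * termVal z (chainOf c)) (perms B))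
    ≡⟨ cong sum (map-cong-local (All.map
         (λ B↭c → termVal*chainOf tz t (Unique-resp-↭ B↭c u) (∈-resp-↭ B↭c ∘ t⊆B)) (perms-↭ B))) ⟩
  sum (map (λ c → b2n (c ⊨ t) * termVal z (chainOf c)) (perms B))
    ≡⟨ sym (sum-map-filterᵇ (_⊨ t) (termVal z ∘ chainOf) (perms B)) ⟩
  sum (map (termVal z ∘ chainOf) (filterᵇ (_⊨ t) (perms B)))
    ≡⟨ cong sum (map-∘ (filterᵇ (_⊨ t) (perms B))) ⟩
  dnfSum z (chainExpansion t B) ∎
  where open ≡-Reasoning

record Frame (k : ℕ) (t : Term (suc n)) : Set where
  field
    carrier : List (Fin (suc n))
    unique : Unique carrier
    zero∈ : Fin.zero ∈ carrier
    length≡k : length carrier ≡ k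
    mentioned⊆ : mentioned t ⊆ carrier

frame : ∀ {k} (t : Term (suc n)) → suc n ⊓ suc (2 * length t) ≤ k → k ≤ suc n → Frame k t
frame {n} t min≤k k≤n =
  let ys , ys-unique , S⊆ys , |ys| = extend-unique S-unique (≤-trans |S|≤ min≤k) k≤n in record
  { carrier = ys
  ; unique = ys-unique
  ; zero∈ = S⊆ys (∈-deduplicate⁺ _≟_ {xs = Fin.zero ∷ mentioned t} (here refl))
  ; length≡k = |ys|
  ; mentioned⊆ = S⊆ys ∘ ∈-deduplicate⁺ _≟_ {xs = Fin.zero ∷ mentioned t} ∘ there
  }
  where
  S : List (Fin (suc n))
  S = deduplicate _≟_ (Fin.zero ∷ mentioned t)
  S-unique : Unique S
  S-unique = UniqueDec.deduplicate-! _≟_ (Fin.zero ∷ mentioned t)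
  |S|≤ : length S ≤ suc n ⊓ suc (2 * length t)
  |S|≤ = ⊓-glb (Unique⇒length≤ S-unique)
           (≤-trans (length-deduplicate _≟_ (Fin.zero ∷ mentioned t)) (s≤s (≤-reflexive (length-mentioned t))))

normalize : ∀ {k} {W : DNF (suc n)} → All (Frame k) W → DNF (suc n)
normalize [] = []
normalize {W = t ∷ _} (F ∷ Fs) = chainExpansion t (Frame.carrier F) ++ normalize Fs

normalize-isChainTerm : ∀ {k} {W : DNF (suc n)} (Fs : All (Frame k) W) → All (IsChainTerm k) (normalize Fs)
normalize-isChainTerm [] = []
normalize-isChainTerm {W = t ∷ _} (F ∷ Fs) =
  ++⁺ (chainExpansion-isChainTerm t unique zero∈ length≡k) (normalize-isChainTerm Fs)
  where open Frame F

dnfSum-normalize : ∀ {k} {z : Assignment (suc n)} → IsTotalOrder z → ∀ {W} (Fs : All (Frame k) W) →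
  dnfSum z W ≡ dnfSum z (normalize Fs)
dnfSum-normalize tz [] = refl
dnfSum-normalize {z = z} tz {t ∷ _} (F ∷ Fs) =
  trans (cong₂ _+_ (termVal≡dnfSum-chainExpansion tz t unique mentioned⊆) (dnfSum-normalize tz Fs))
        (sym (dnfSum-++ z (chainExpansion t carrier) (normalize Fs)))
  where open Frame F

lemma4p4 : (n d : ℕ) → 2 ≤ n → 1 ≤ d → (W : DNF n) → HasDegree d W →
    ∃ λ (N : DNF n) → ∃ λ (k : ℕ) → NormalizedOfSize k N × k ≤ 2 * d + 1 ×
      All (λ z → accepts W z ≡ accepts N z) (Ord n) × Ẽ W ≡ Ẽ N
lemma4p4 zero _ () _ _ _
lemma4p4 (suc m) d 2≤n 1≤d W deg =
  normalize frames , k , (2≤k , normalize-isChainTerm frames) , m⊓n≤n (suc m) (2 * d + 1) ,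
  All.map (λ tz → accepts-resp-dnfSum W (normalize frames) (dnfSum-normalize tz frames)) Ord-isTotalOrder ,
  Ẽ-resp-dnfSum W (normalize frames) (All.map (λ tz → dnfSum-normalize tz frames) Ord-isTotalOrder)
  where
  k : ℕ
  k = suc m ⊓ (2 * d + 1)
  2≤k : 2 ≤ k
  2≤k = ⊓-glb 2≤n (≤-trans (*-monoʳ-≤ 2 1≤d) (m≤m+n (2 * d) 1))
  frames : All (Frame k) W
  frames = All.map (λ {t} |t|≤d → frame t (⊓-monoʳ-≤ (suc m) (width-bound |t|≤d)) (m⊓n≤m (suc m) _)) deg
    where
    width-bound : ∀ {w} → w ≤ d → suc (2 * w) ≤ 2 * d + 1
    width-bound w≤d = ≤-trans (s≤s (*-monoʳ-≤ 2 w≤d)) (≤-reflexive (+-comm 1 (2 * d)))
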